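{- Let $p$ be a prime and let $g$ be a primitive root modulo $p$ with $1<g<p$. The following algorithm (Algorithm 4) computes every value $q_p(u)$, $0\le u< p-1$, using $O(p)$ arithmetic operations on $O(\log p)$-bit integers (the implied constant being absolute): 1. Set $q_p(0)=0$ and $q_p(1)=0$. 2. Compute $q_p(g)$ by repeated squaring modulo $p^2$. 3. Set $b_1=g$ and $c_1=g^{ -1}~\mathrm{rem}~p$. 4. For $i=2,\ldots,p-2$: (a) compute $b_i=g b_{i-1}~\mathrm{rem}~p$ and $c_i=c_{i-1}g^{ -1}~\mathrm{rem}~p$; (b) compute $k_i=(g b_{i-1}-b_i)/p$; (c) set $q_p(b_i)=\big(q_p(g)+q_p(b_{i-1})+k_i c_i\big)~\mathrm{rem}~p$. The output is the sequence of values $q_p(u)$, listed in the (permuted) order $q_p(0),q_p(1),q_p(b_1),\ldots,q_p(b_{p-2})$.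
   Context: For a prime $p$ and an integer $u$ with $\gcd(u,p)=1$, the Fermat quotient $q_p(u)$ is the unique integer with $q_p(u)\equiv (u^{p-1}-1)/p \pmod p$ and $0\le q_p(u)\le p-1$; also $q_p(kp)=0$ for all $k\in\mathbb Z$. For integers $a,b$ and $m\ge1$ with $\gcd(b,m)=1$, $c=a/b~\mathrm{rem}~m$ denotes the unique integer $c$ with $bc\equiv a\pmod m$ and $0\le c<m$ (in particular $a~\mathrm{rem}~m$ is the least nonnegative residue of $a$ modulo $m$). -}

module Defs where

open import Data.Nat using (ℕ; zero; suc; _+_; _*_; _∸_; _^_; _≤_; _<_; _⊔_; _≡ᵇ_)
open import Data.Nat.DivMod using (_/_; _%_)
open import Data.Bool using (if_then_else_)
open import Data.List using (List; []; _∷_)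
open import Data.Product using (_×_; _,_)
open import Relation.Binary.PropositionalEquality using (_≡_; _≢_)

-- Division / remainder on ℕ, total (value 0 for divisor 0; never used with 0 below).
divN : ℕ → ℕ → ℕ
divN a zero    = 0
divN a (suc b) = a / suc b

remN : ℕ → ℕ → ℕ
remN a zero    = a
remN a (suc b) = a % suc b

fq : ℕ → ℕ → ℕ
fq p u = if remN u p ≡ᵇ 0 then 0 else remN (divN (u ^ (p ∸ 1) ∸ 1) p) p

IsPrimitiveRoot : ℕ → ℕ → Set
IsPrimitiveRoot p g =
  (remN (g ^ (p ∸ 1)) p ≡ 1) ×
  (∀ k → 1 ≤ k → k < p ∸ 1 → remN (g ^ k) p ≢ 1)

-- Cost model: a computation returns a value, the number of arithmetic
-- operations performed, and the largest integer (operand or result)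
-- occurring in any of those operations.

record Costed (A : Set) : Set where
  constructor ⟨_,_,_⟩
  field
    val : A
    ops : ℕ
    big : ℕ
open Costed public

pure : {A : Set} → A → Costed A
pure x = ⟨ x , 0 , 0 ⟩

_>>=_ : {A B : Set} → Costed A → (A → Costed B) → Costed B
m >>= f = ⟨ val (f (val m)) , ops m + ops (f (val m)) , big m ⊔ big (f (val m)) ⟩

prim : (ℕ → ℕ → ℕ) → ℕ → ℕ → Costed ℕ
prim f a b = ⟨ f a b , 1 , a ⊔ b ⊔ f a b ⟩

-- square-and-multiply: acc * b^e rem m  (fuel ≥ e suffices)
pm : ℕ → ℕ → ℕ → ℕ → ℕ → Costed ℕ
pm zero    acc b e       m = pure acc
pm (suc f) acc b zero    m = pure acc
pm (suc f) acc b (suc e) m = do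
  bit ← prim remN (suc e) 2
  h   ← prim divN (suc e) 2
  acc' ← (if bit ≡ᵇ 1
           then (prim _*_ acc b >>= λ t → prim remN t m)
           else pure acc)
  b2 ← prim _*_ b b
  b' ← prim remN b2 m
  pm f acc' b' h m

powmod : ℕ → ℕ → ℕ → Costed ℕ
powmod b e m = pm e 1 b e m

-- Step 4 of Algorithm 4; parameters p, g, ginv = g^{-1} rem p, qg = q_p(g);
-- state (b_{i-1}, c_{i-1}, q_p(b_{i-1})); outputs pairs (b_i , q_p(b_i)).
loop : ℕ → ℕ → ℕ → ℕ → ℕ → ℕ → ℕ → ℕ → Costed (List (ℕ × ℕ))
loop p g ginv qg zero    b c q = pure []
loop p g ginv qg (suc n) b c q = do
  t  ← prim _*_ g b
  b' ← prim remN t p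
  t2 ← prim _*_ c ginv
  c' ← prim remN t2 p
  d  ← prim _∸_ t b'
  k  ← prim divN d p
  s1 ← prim _+_ qg q
  kc ← prim _*_ k c'
  s2 ← prim _+_ s1 kc
  q' ← prim remN s2 p
  rest ← loop p g ginv qg n b' c' q'
  pure ((b' , q') ∷ rest)

-- Algorithm 4.  Output: list of pairs (u , computed q_p(u)) in the order
-- u = 0, 1, b_1, ..., b_{p-2}.
algorithm4 : ℕ → ℕ → Costed (List (ℕ × ℕ))
algorithm4 p g = do
  p2 ← prim _*_ p p
  e  ← prim _∸_ p 1
  r  ← powmod g e p2
  r1 ← prim _∸_ r 1
  qg ← prim divN r1 p
  e2 ← prim _∸_ p 2
  gi ← powmod g e2 p           -- c_1 = g^{-1} rem p  (= g^{p-2} rem p)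
  rest ← loop p g gi qg (p ∸ 3) g gi qg
  pure ((0 , 0) ∷ (1 , 0) ∷ (g , qg) ∷ rest)

{-# OPTIONS --safe #-}
-- Call q a Fermat quotient of u when u^(P-1) ≡ 1 + q P (mod P²); then q ≡ q_P(u) (mod P), and
-- q(g b) ≡ q(g) + q(b). Step 4 writes g b_{i-1} = b_i + k_i P, and the binomial expansion
-- (b_i + k_i P)^(P-1) ≡ b_i^(P-1) - k_i b_i^(P-2) P (mod P²) with b_i^(P-2) ≡ b_i⁻¹ ≡ c_i gives
-- q(b_i) ≡ q(g) + q(b_{i-1}) + k_i c_i (mod P). As g has order P-1, the b_i = g^i rem P are
-- 2, ..., P-1 in some order. Every iteration of step 4 costs ten
-- operations on numbers below P² + 2P, and each repeated squaring at most 6(P-1) operations on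
-- numbers below P⁴.
module Submission where

open import Defs
open import Data.Nat
open import Data.Nat.Properties
open import Data.Nat.DivMod
open import Algebra.Properties.CommutativeSemigroup *-commutativeSemigroup using (interchange)
open import Data.Nat.Divisibility using (divides)
open import Data.Nat.Primality using (Prime)
open import Data.Nat.Tactic.RingSolver using (solve-∀)
open import Data.Bool using (if_then_else_)
open import Data.Fin using (Fin; zero; suc; toℕ; fromℕ<)
open import Data.Fin.Properties using (pigeonhole; toℕ-fromℕ<)
open import Data.List using (List; _∷_; map; upTo; applyUpTo; length; lookup)
open import Data.List.Properties using (length-applyUpTo; map-upTo)
open import Data.List.Relation.Unary.All as All using (All; []; _∷_)
open import Data.List.Relation.Unary.All.Properties using (¬Any⇒All¬; applyUpTo⁺₁)
open import Data.List.Relation.Unary.AllPairs using (_∷_)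
open import Data.List.Relation.Unary.Unique.Propositional using (Unique)
import Data.List.Relation.Unary.Unique.Propositional.Properties as UniqueP
open UniqueP using (upTo⁺)
open import Data.List.Membership.Propositional using (_∈_)
open import Data.List.Membership.Propositional.Properties using (∈-lookup; ∈-upTo⁺; ∈-upTo⁻)
open import Data.List.Membership.Propositional.Properties.WithK using (unique∧set⇒bag)
open import Data.List.Membership.DecPropositional _≟_ using (_∈?_)
open import Data.List.Relation.Binary.BagAndSetEquality using (∼bag⇒↭)
open import Data.List.Relation.Binary.Permutation.Propositional using (_↭_)
open import Data.Product using (Σ; _×_; _,_; proj₁; proj₂)
open import Data.Empty using (⊥-elim)
open import Function using (_∘_; _$_)
open import Function.Bundles using (mk⇔)
open import Level using (0ℓ)
open import Relation.Binary.Bundles using (Setoid)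
open import Relation.Binary.Structures using (IsEquivalence)
import Relation.Binary.Reasoning.Setoid
open import Relation.Binary.PropositionalEquality
  using (_≡_; _≢_; refl; sym; trans; cong; cong₂; subst; module ≡-Reasoning)
open import Relation.Nullary using (yes; no)

module Congruence (n : ℕ) .{{_ : NonZero n}} where

  infix 4 _≈_
  record _≈_ (a b : ℕ) : Set where
    constructor mk
    field
      %-≡ : a % n ≡ b % n
  open _≈_ public

  isEquivalence : IsEquivalence _≈_
  isEquivalence = record
    { refl  = mk refl
    ; sym   = λ (mk e) → mk (sym e)
    ; trans = λ (mk e) (mk f) → mk (trans e f)
    }

  setoid : Setoid 0ℓ 0ℓ
  setoid = record { isEquivalence = isEquivalence }

  open IsEquivalence isEquivalence public
    using () renaming (refl to ≈-refl; sym to ≈-sym; trans to ≈-trans; reflexive to ≡⇒≈)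

  +-cong : ∀ {a b c d} → a ≈ b → c ≈ d → a + c ≈ b + d
  +-cong {a} {b} {c} {d} (mk e₁) (mk e₂) = mk $ begin
    (a + c) % n             ≡⟨ %-distribˡ-+ a c n ⟩
    (a % n + c % n) % n     ≡⟨ cong₂ (λ x y → (x + y) % n) e₁ e₂ ⟩
    (b % n + d % n) % n     ≡⟨ %-distribˡ-+ b d n ⟨
    (b + d) % n             ∎
    where open ≡-Reasoning

  *-cong : ∀ {a b c d} → a ≈ b → c ≈ d → a * c ≈ b * d
  *-cong {a} {b} {c} {d} (mk e₁) (mk e₂) = mk $ begin
    (a * c) % n             ≡⟨ %-distribˡ-* a c n ⟩
    (a % n * (c % n)) % n   ≡⟨ cong₂ (λ x y → (x * y) % n) e₁ e₂ ⟩
    (b % n * (d % n)) % n   ≡⟨ %-distribˡ-* b d n ⟨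
    (b * d) % n             ∎
    where open ≡-Reasoning

  ^-cong : ∀ {a b} k → a ≈ b → a ^ k ≈ b ^ k
  ^-cong zero    _   = ≈-refl
  ^-cong (suc k) a≈b = *-cong a≈b (^-cong k a≈b)

  m%n≈m : ∀ a → a % n ≈ a
  m%n≈m a = mk (m%n%n≡m%n a n)

  m+kn≈m : ∀ a k → a + k * n ≈ a
  m+kn≈m a k = mk ([m+kn]%n≡m%n a k n)

  kn≈0 : ∀ k → k * n ≈ 0
  kn≈0 k = ≈-trans (≡⇒≈ (sym (+-identityˡ (k * n)))) (m+kn≈m 0 k)

  module ≈-Reasoning = Relation.Binary.Reasoning.Setoid setoid

^-distribʳ-* : ∀ a b k → (a * b) ^ k ≡ a ^ k * b ^ k
^-distribʳ-* a b zero    = refl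
^-distribʳ-* a b (suc k) = begin
  a * b * (a * b) ^ k         ≡⟨ cong (a * b *_) (^-distribʳ-* a b k) ⟩
  a * b * (a ^ k * b ^ k)     ≡⟨ interchange a b (a ^ k) (b ^ k) ⟩
  a * a ^ k * (b * b ^ k)     ∎
  where open ≡-Reasoning

[m*m]^n≡m^[n*2] : ∀ b h → (b * b) ^ h ≡ b ^ (h * 2)
[m*m]^n≡m^[n*2] b h = trans (cong (_^ h) (cong (b *_) (sym (*-identityʳ b))))
                     (trans (^-*-assoc b 2 h) (cong (b ^_) (*-comm 2 h)))

⊔-lub₃ : ∀ {a b c B} → a ≤ B → b ≤ B → c ≤ B → a ⊔ b ⊔ c ≤ B
⊔-lub₃ a≤B b≤B c≤B = ⊔-lub (⊔-lub a≤B b≤B) c≤B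

-- Definitionally equal to the conditional multiplication in the body of pm.
multiplyIf : ℕ → ℕ → ℕ → ℕ → Costed ℕ
multiplyIf bit acc b m =
  if bit ≡ᵇ 1 then (prim _*_ acc b >>= λ t → prim remN t m) else pure acc

acc≡acc*b^0%m : ∀ acc b m → acc < suc m → acc ≡ acc * b ^ 0 % suc m
acc≡acc*b^0%m acc b m acc<m = sym (trans (cong (_% suc m) (*-identityʳ acc)) (m<n⇒m%n≡m acc<m))

multiplyIf-val : ∀ bit acc b m → bit < 2 → acc < suc m →
                 val (multiplyIf bit acc b (suc m)) ≡ acc * b ^ bit % suc m
multiplyIf-val 0 acc b m _ acc<m = acc≡acc*b^0%m acc b m acc<m
multiplyIf-val 1 acc b m _ _     = cong (λ x → acc * x % suc m) (sym (*-identityʳ b))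
multiplyIf-val (suc (suc _)) _ _ _ (s≤s (s≤s ())) _

multiplyIf-ops : ∀ bit acc b m → ops (multiplyIf bit acc b m) ≤ 2
multiplyIf-ops 0               _ _ _ = z≤n
multiplyIf-ops 1               _ _ _ = ≤-refl
multiplyIf-ops (suc (suc bit)) _ _ _ = z≤n

multiplyIf-big : ∀ bit acc b m → acc < suc m → b < suc m →
                 big (multiplyIf bit acc b (suc m)) ≤ suc m * suc m
multiplyIf-big 0               _ _ _ _ _ = z≤n
multiplyIf-big 1 acc b m acc<m b<m =
  ⊔-lub (⊔-lub₃ (<⇒≤ (≤-trans acc<m m≤m²)) (<⇒≤ (≤-trans b<m m≤m²)) ab≤m²)
        (⊔-lub₃ ab≤m² m≤m² (≤-trans (m%n≤m (acc * b) (suc m)) ab≤m²))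
  where
  m≤m² = m≤m*n (suc m) (suc m)
  ab≤m² = *-mono-≤ (<⇒≤ acc<m) (<⇒≤ b<m)
multiplyIf-big (suc (suc bit)) _ _ _ _ _ = z≤n

module SquareAndMultiplyStep (acc b e m : ℕ) where
  bit = suc e % 2
  half = suc e / 2
  acc′ = val (multiplyIf bit acc b (suc m))
  b′ = b * b % suc m

  bit<2 : bit < 2
  bit<2 = m%n<n (suc e) 2

  half≤e : half ≤ e
  half≤e = ≤-pred (m/n<m (suc e) 2 (s≤s (s≤s z≤n)))

  acc′<m : acc < suc m → acc′ < suc m
  acc′<m acc<m = subst (_< suc m) (sym (multiplyIf-val bit acc b m bit<2 acc<m))
                       (m%n<n (acc * b ^ bit) (suc m))

  open Congruence (suc m)

  invariant : acc < suc m → acc′ * b′ ^ half ≈ acc * b ^ suc e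
  invariant acc<m = begin
    acc′ * b′ ^ half                     ≈⟨ *-cong (≡⇒≈ (multiplyIf-val bit acc b m bit<2 acc<m))
                                                   (^-cong half (m%n≈m (b * b))) ⟩
    acc * b ^ bit % suc m * (b * b) ^ half ≈⟨ *-cong (m%n≈m (acc * b ^ bit)) ≈-refl ⟩
    acc * b ^ bit * (b * b) ^ half       ≡⟨ cong (acc * b ^ bit *_) ([m*m]^n≡m^[n*2] b half) ⟩
    acc * b ^ bit * b ^ (half * 2)       ≡⟨ *-assoc acc (b ^ bit) _ ⟩
    acc * (b ^ bit * b ^ (half * 2))     ≡⟨ cong (acc *_) (^-distribˡ-+-* b bit (half * 2)) ⟨
    acc * b ^ (bit + half * 2)           ≡⟨ cong (λ x → acc * b ^ x) (m≡m%n+[m/n]*n (suc e) 2) ⟨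
    acc * b ^ suc e                      ∎
    where open ≈-Reasoning

pm-val : ∀ f acc b e m → acc < suc m → e ≤ f →
         val (pm f acc b e (suc m)) ≡ acc * b ^ e % suc m
pm-val zero    acc b zero    m acc<m _ = acc≡acc*b^0%m acc b m acc<m
pm-val (suc f) acc b zero    m acc<m _ = acc≡acc*b^0%m acc b m acc<m
pm-val (suc f) acc b (suc e) m acc<m (s≤s e≤f) = begin
  val (pm f acc′ b′ half (suc m)) ≡⟨ pm-val f acc′ b′ half m (acc′<m acc<m) (≤-trans half≤e e≤f) ⟩
  acc′ * b′ ^ half % suc m        ≡⟨ %-≡ (invariant acc<m) ⟩
  acc * b ^ suc e % suc m         ∎
  where
  open SquareAndMultiplyStep acc b e m
  open Congruence (suc m) using (%-≡)
  open ≡-Reasoning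

pm-ops : ∀ f acc b e m → ops (pm f acc b e (suc m)) ≤ 6 * e
pm-ops zero    _   _ _       _ = z≤n
pm-ops (suc f) _   _ zero    _ = z≤n
pm-ops (suc f) acc b (suc e) m = begin
  2 + (ops (multiplyIf bit acc b (suc m)) + (2 + ops (pm f acc′ b′ half (suc m))))
    ≤⟨ +-monoʳ-≤ 2 (+-mono-≤ (multiplyIf-ops bit acc b (suc m))
                             (+-monoʳ-≤ 2 (pm-ops f acc′ b′ half m))) ⟩
  2 + (2 + (2 + 6 * half))  ≤⟨ +-monoʳ-≤ 6 (*-monoʳ-≤ 6 half≤e) ⟩
  6 + 6 * e                 ≡⟨ *-suc 6 e ⟨
  6 * suc e                 ∎
  where
  open SquareAndMultiplyStep acc b e m
  open ≤-Reasoning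

pm-big : ∀ f acc b e m B → acc < suc m → b < suc m → suc e ≤ B → 2 ≤ B → suc m * suc m ≤ B →
         big (pm f acc b e (suc m)) ≤ B
pm-big zero    _   _ _       _ _ _     _   _   _   _    = z≤n
pm-big (suc f) _   _ zero    _ _ _     _   _   _   _    = z≤n
pm-big (suc f) acc b (suc e) m B acc<m b<m 2+e≤B 2≤B m²≤B =
  ⊔-lub (⊔-lub₃ 1+e≤B 2≤B (≤-trans (<⇒≤ bit<2) 2≤B)) $
  ⊔-lub (⊔-lub₃ 1+e≤B 2≤B (≤-trans (m/n≤m (suc e) 2) 1+e≤B)) $
  ⊔-lub (≤-trans (multiplyIf-big bit acc b m acc<m b<m) m²≤B) $
  ⊔-lub (⊔-lub₃ b≤B b≤B b²≤B) $
  ⊔-lub (⊔-lub₃ b²≤B (≤-trans (m≤m*n (suc m) (suc m)) m²≤B) (≤-trans (m%n≤m (b * b) (suc m)) b²≤B)) $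
  pm-big f acc′ b′ half m B (acc′<m acc<m) (m%n<n (b * b) (suc m))
         (≤-trans (s≤s half≤e) 1+e≤B) 2≤B m²≤B
  where
  open SquareAndMultiplyStep acc b e m
  1+e≤B = ≤-trans (n≤1+n (suc e)) 2+e≤B
  b²≤B = ≤-trans (*-mono-≤ (<⇒≤ b<m) (<⇒≤ b<m)) m²≤B
  b≤B = ≤-trans (<⇒≤ b<m) (≤-trans (m≤m*n (suc m) (suc m)) m²≤B)

[m∸m%n]/n≡m/n : ∀ m n .{{_ : NonZero n}} → (m ∸ m % n) / n ≡ m / n
[m∸m%n]/n≡m/n m n = begin
  (m ∸ m % n) / n                 ≡⟨ cong (λ x → (x ∸ m % n) / n) (m≡m%n+[m/n]*n m n) ⟩
  (m % n + m / n * n ∸ m % n) / n ≡⟨ cong (_/ n) (m+n∸m≡n (m % n) (m / n * n)) ⟩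
  m / n * n / n                   ≡⟨ m*n/n≡m (m / n) n ⟩
  m / n                           ∎
  where open ≡-Reasoning

m%n≡1⇒m≡1+[m∸1]/n*n : ∀ m n .{{_ : NonZero n}} → m % n ≡ 1 → m ≡ 1 + (m ∸ 1) / n * n
m%n≡1⇒m≡1+[m∸1]/n*n m n m%n≡1 = begin
  m                      ≡⟨ m≡m%n+[m/n]*n m n ⟩
  m % n + m / n * n      ≡⟨ cong (λ r → r + m / n * n) m%n≡1 ⟩
  1 + m / n * n          ≡⟨ cong (λ x → 1 + x * n) ([m∸m%n]/n≡m/n m n) ⟨
  1 + (m ∸ m % n) / n * n ≡⟨ cong (λ r → 1 + (m ∸ r) / n * n) m%n≡1 ⟩
  1 + (m ∸ 1) / n * n    ∎
  where open ≡-Reasoning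

lookup-unique : ∀ {xs : List ℕ} → Unique xs → ∀ {i j} → toℕ i < toℕ j → lookup xs i ≢ lookup xs j
lookup-unique {_ ∷ xs} (x∉xs ∷ _)  {zero}  {suc j} _         = All.lookup x∉xs (∈-lookup {xs = xs} j)
lookup-unique          (_ ∷ xs!)   {suc i} {suc j} (s≤s i<j) = lookup-unique xs! i<j

unique⇒length≤ : ∀ {N} xs → Unique xs → All (_< N) xs → length xs ≤ N
unique⇒length≤ {N} xs xs! xs<N = ≮⇒≥ N≮length
  where
  bound : ∀ i → lookup xs i < N
  bound i = All.lookup xs<N (∈-lookup i)
  toFin : Fin (length xs) → Fin N
  toFin i = fromℕ< (bound i)
  N≮length : N ≮ length xs
  N≮length N<length with i , j , i<j , f[i]≡f[j] ← pigeonhole N<length toFin =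
    lookup-unique xs! i<j $ begin
      lookup xs i     ≡⟨ toℕ-fromℕ< (bound i) ⟨
      toℕ (toFin i)   ≡⟨ cong toℕ f[i]≡f[j] ⟩
      toℕ (toFin j)   ≡⟨ toℕ-fromℕ< (bound j) ⟩
      lookup xs j     ∎
    where open ≡-Reasoning

unique∧bounded⇒↭upTo : ∀ N xs → Unique xs → All (_< N) xs → length xs ≡ N → xs ↭ upTo N
unique∧bounded⇒↭upTo N xs xs! xs<N len≡N =
  ∼bag⇒↭ (unique∧set⇒bag xs! (upTo⁺ N) (mk⇔ (∈-upTo⁺ ∘ All.lookup xs<N) complete))
  where
  complete : ∀ {x} → x ∈ upTo N → x ∈ xs
  complete {x} x∈upTo with x ∈? xs
  ... | yes x∈xs = x∈xs
  ... | no  x∉xs = ⊥-elim $ 1+n≰n $ subst (λ l → suc l ≤ N) len≡N $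
    unique⇒length≤ (x ∷ xs) (¬Any⇒All¬ xs x∉xs ∷ xs!) (∈-upTo⁻ x∈upTo ∷ xs<N)

module FermatQuotient (n : ℕ) where

  P : ℕ
  P = suc (suc n)

  module ModP = Congruence P
  module ModP² = Congruence (P * P)
  open ModP using () renaming (_≈_ to _≈ₚ_)
  open ModP² using () renaming (_≈_ to _≈ₚ²_)

  IsFermatQuotient : ℕ → ℕ → Set
  IsFermatQuotient u q = u ^ suc n ≈ₚ² 1 + q * P

  ≈ₚ²⇒≈ₚ : ∀ {a b} → a ≈ₚ² b → a ≈ₚ b
  ≈ₚ²⇒≈ₚ {a} {b} (ModP².mk e) = ModP.mk $ begin
    a % P           ≡⟨ m∣n⇒o%n%m≡o%m P (P * P) a (divides P refl) ⟨
    a % (P * P) % P ≡⟨ cong (_% P) e ⟩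
    b % (P * P) % P ≡⟨ m∣n⇒o%n%m≡o%m P (P * P) b (divides P refl) ⟩
    b % P           ∎
    where open ≡-Reasoning

  *P-cong : ∀ {a b} → a ≈ₚ b → a * P ≈ₚ² b * P
  *P-cong {a} {b} (ModP.mk e) = ModP².mk $ begin
    a * P % (P * P) ≡⟨ m%n*o≡m*o%[n*o] a P P ⟨
    a % P * P       ≡⟨ cong (_* P) e ⟩
    b % P * P       ≡⟨ m%n*o≡m*o%[n*o] b P P ⟩
    b * P % (P * P) ∎
    where open ≡-Reasoning

  1+*P-cancel : ∀ a b → 1 + a * P ≈ₚ² 1 + b * P → a ≈ₚ b
  1+*P-cancel a b (ModP².mk e) = ModP.mk $ *-cancelʳ-≡ (a % P) (b % P) P $ +-cancelʳ-≡ _ _ _ $ begin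
    a % P * P + 1         ≡⟨ %P*P+1 a ⟩
    (1 + a * P) % (P * P) ≡⟨ e ⟩
    (1 + b * P) % (P * P) ≡⟨ %P*P+1 b ⟨
    b % P * P + 1         ∎
    where
    open ≡-Reasoning
    %P*P+1 : ∀ x → x % P * P + 1 ≡ (1 + x * P) % (P * P)
    %P*P+1 x = begin
      x % P * P + 1         ≡⟨ cong (_+ 1) (m%n*o≡m*o%[n*o] x P P) ⟩
      x * P % (P * P) + 1   ≡⟨ [m*n+o]%[p*n]≡[m*n]%[p*n]+o x P (s≤s (s≤s z≤n)) ⟨
      (x * P + 1) % (P * P) ≡⟨ cong (_% (P * P)) (+-comm (x * P) 1) ⟩
      (1 + x * P) % (P * P) ∎

  pow≈1 : ∀ u q → IsFermatQuotient u q → u ^ suc n ≈ₚ 1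
  pow≈1 u q u^e≈ = ModP.≈-trans (≈ₚ²⇒≈ₚ u^e≈) (ModP.m+kn≈m 1 q)

  fq-unique : ∀ u q → IsFermatQuotient u q → q < P → fq P u ≡ q
  fq-unique u q u^e≈ q<P with u % P in u%P≡
  ... | zero  = ⊥-elim (0≢1+n (ModP.%-≡ 0≈1))
    where
    open ModP.≈-Reasoning
    0≈1 : 0 ≈ₚ 1
    0≈1 = begin
      0 * u ^ n ≈⟨ ModP.*-cong {0} {u} (ModP.mk (sym u%P≡)) (ModP.≈-refl {u ^ n}) ⟩
      u * u ^ n ≈⟨ pow≈1 u q u^e≈ ⟩
      1         ∎
  ... | suc _ = begin
    (U ∸ 1) / P % P ≡⟨ ModP.%-≡ (1+*P-cancel ((U ∸ 1) / P) q (ModP².≈-trans (ModP².≡⇒≈ (sym U≡)) u^e≈)) ⟩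
    q % P           ≡⟨ m<n⇒m%n≡m q<P ⟩
    q               ∎
    where
    open ≡-Reasoning
    U = u ^ suc n
    U≡ : U ≡ 1 + (U ∸ 1) / P * P
    U≡ = m%n≡1⇒m≡1+[m∸1]/n*n U P (ModP.%-≡ (pow≈1 u q u^e≈))

  isFermatQuotient-% : ∀ u q → IsFermatQuotient u q → IsFermatQuotient u (q % P)
  isFermatQuotient-% u q u^e≈ =
    ModP².≈-trans u^e≈ (ModP².+-cong {1} {1} ModP².≈-refl (*P-cong (ModP.≈-sym (ModP.m%n≈m q))))

  isFermatQuotient-* : ∀ g b qg q → IsFermatQuotient g qg → IsFermatQuotient b q →
                       IsFermatQuotient (g * b) (qg + q)
  isFermatQuotient-* g b qg q g^e≈ b^e≈ = begin
    (g * b) ^ suc n                            ≡⟨ ^-distribʳ-* g b (suc n) ⟩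
    g ^ suc n * b ^ suc n                      ≈⟨ ModP².*-cong g^e≈ b^e≈ ⟩
    (1 + qg * P) * (1 + q * P)                 ≡⟨ expand qg q P ⟩
    1 + (qg + q) * P + qg * q * (P * P)        ≈⟨ ModP².m+kn≈m (1 + (qg + q) * P) (qg * q) ⟩
    1 + (qg + q) * P                           ∎
    where
    open ModP².≈-Reasoning
    expand : ∀ a b x → (1 + a * x) * (1 + b * x) ≡ 1 + (a + b) * x + a * b * (x * x)
    expand = solve-∀

  binomial-+kP : ∀ m x k → (x + k * P) ^ suc m ≈ₚ² x ^ suc m + suc m * x ^ m * k * P
  binomial-+kP zero    x k = ModP².≡⇒≈ (expand x k P)
    where
    expand : ∀ x k y → (x + k * y) * 1 ≡ x * 1 + 1 * 1 * k * y
    expand = solve-∀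
  binomial-+kP (suc m) x k = begin
    (x + k * P) * (x + k * P) ^ suc m
      ≈⟨ ModP².*-cong (ModP².≈-refl {x + k * P}) (binomial-+kP m x k) ⟩
    (x + k * P) * (x * x ^ m + suc m * x ^ m * k * P)
      ≡⟨ expand x (x ^ m) k P m ⟩
    x * (x * x ^ m) + suc (suc m) * (x * x ^ m) * k * P + k * suc m * x ^ m * k * (P * P)
      ≈⟨ ModP².m+kn≈m _ (k * suc m * x ^ m * k) ⟩
    x * (x * x ^ m) + suc (suc m) * (x * x ^ m) * k * P
      ∎
    where
    open ModP².≈-Reasoning
    expand : ∀ x a k y m → (x + k * y) * (x * a + (1 + m) * a * k * y)
                         ≡ x * (x * a) + (2 + m) * (x * a) * k * y + k * (1 + m) * a * k * (y * y)
    expand = solve-∀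

  x^n≈inverse : ∀ x c → x ^ suc n ≈ₚ 1 → x * c ≈ₚ 1 → x ^ n ≈ₚ c
  x^n≈inverse x c x^e≈1 xc≈1 = begin
    x ^ n             ≡⟨ *-identityʳ _ ⟨
    x ^ n * 1         ≈⟨ ModP.*-cong (ModP.≈-refl {x ^ n}) (ModP.≈-sym xc≈1) ⟩
    x ^ n * (x * c)   ≡⟨ reassociate (x ^ n) x c ⟩
    x * x ^ n * c     ≈⟨ ModP.*-cong x^e≈1 (ModP.≈-refl {c}) ⟩
    1 * c             ≡⟨ *-identityˡ c ⟩
    c                 ∎
    where
    open ModP.≈-Reasoning
    reassociate : ∀ a x c → a * (x * c) ≡ x * a * c
    reassociate = solve-∀

  [1+n]*x^n+c≈0 : ∀ x c → x ^ suc n ≈ₚ 1 → x * c ≈ₚ 1 → suc n * x ^ n + c ≈ₚ 0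
  [1+n]*x^n+c≈0 x c x^e≈1 xc≈1 = begin
    suc n * x ^ n + c  ≈⟨ ModP.+-cong (ModP.*-cong (ModP.≈-refl {suc n}) (x^n≈inverse x c x^e≈1 xc≈1))
                                      (ModP.≈-refl {c}) ⟩
    suc n * c + c      ≡⟨ +-comm (suc n * c) c ⟩
    P * c              ≡⟨ *-comm P c ⟩
    c * P              ≈⟨ ModP.kn≈0 c ⟩
    0                  ∎
    where open ModP.≈-Reasoning

  isFermatQuotient-shift : ∀ x k c q → IsFermatQuotient (x + k * P) q → x * c ≈ₚ 1 →
                           IsFermatQuotient x (q + k * c)
  isFermatQuotient-shift x k c q shifted xc≈1 = begin
    x ^ e                                   ≡⟨ +-identityʳ _ ⟨
    x ^ e + 0                               ≈⟨ ModP².+-cong (ModP².≈-refl {x ^ e})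
                                                 (ModP².≈-sym (*P-cong (ModP.*-cong X≈0 (ModP.≈-refl {k})))) ⟩
    x ^ e + X * k * P                       ≡⟨ rearrange (x ^ e) (x ^ n) k c P n ⟩
    x ^ e + e * x ^ n * k * P + k * c * P   ≈⟨ ModP².+-cong (ModP².≈-sym (binomial-+kP n x k))
                                                             (ModP².≈-refl {k * c * P}) ⟩
    (x + k * P) ^ e + k * c * P             ≈⟨ ModP².+-cong shifted (ModP².≈-refl {k * c * P}) ⟩
    1 + q * P + k * c * P                   ≡⟨ collect q (k * c) P ⟩
    1 + (q + k * c) * P                     ∎
    where
    open ModP².≈-Reasoning
    e = suc n
    X = e * x ^ n + c
    X≈0 : X ≈ₚ 0
    X≈0 = [1+n]*x^n+c≈0 x c
      (ModP.≈-trans (ModP.^-cong e (ModP.≈-sym (ModP.m+kn≈m x k))) (pow≈1 (x + k * P) q shifted)) xc≈1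
    rearrange : ∀ a b k c y m → a + ((1 + m) * b + c) * k * y ≡ a + (1 + m) * b * k * y + k * c * y
    rearrange = solve-∀
    collect : ∀ q r y → 1 + q * y + r * y ≡ 1 + (q + r) * y
    collect = solve-∀

  isFermatQuotient-rem : ∀ u → u ^ suc n % P ≡ 1 →
                         let q = (u ^ suc n % (P * P) ∸ 1) / P in IsFermatQuotient u q × q < P
  isFermatQuotient-rem u u^e%P≡1 =
    ModP².≈-trans (ModP².≈-sym (ModP².m%n≈m U)) (ModP².≡⇒≈ r≡) ,
    m<n*o⇒m/o<n (≤-<-trans (m∸n≤m r 1) (m%n<n U (P * P)))
    where
    U = u ^ suc n
    r = U % (P * P)
    r≡ : r ≡ 1 + (r ∸ 1) / P * P
    r≡ = m%n≡1⇒m≡1+[m∸1]/n*n r P (trans (m∣n⇒o%n%m≡o%m P (P * P) U (divides P refl)) u^e%P≡1)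

module Loop (n g gi qg : ℕ) where
  open FermatQuotient n
  open ModP using () renaming (_≈_ to _≈ₚ_)

  module Step (b c q : ℕ) where
    t = g * b
    b′ = t % P
    c′ = c * gi % P
    k = (t ∸ b′) / P
    q′ = (qg + q + k * c′) % P

    t≡b′+kP : t ≡ b′ + k * P
    t≡b′+kP = trans (m≡m%n+[m/n]*n t P) (cong (λ x → b′ + x * P) (sym ([m∸m%n]/n≡m/n t P)))

    b′c′≈1 : g * gi ≈ₚ 1 → b * c ≈ₚ 1 → b′ * c′ ≈ₚ 1
    b′c′≈1 ggi≈1 bc≈1 = begin
      b′ * c′           ≈⟨ ModP.*-cong (ModP.m%n≈m t) (ModP.m%n≈m (c * gi)) ⟩
      g * b * (c * gi)  ≡⟨ regroup g b c gi ⟩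
      g * gi * (b * c)  ≈⟨ ModP.*-cong ggi≈1 bc≈1 ⟩
      1                 ∎
      where
      open ModP.≈-Reasoning
      regroup : ∀ g b c i → g * b * (c * i) ≡ g * i * (b * c)
      regroup = solve-∀

    isFermatQuotient-q′ : IsFermatQuotient g qg → g * gi ≈ₚ 1 → IsFermatQuotient b q → b * c ≈ₚ 1 →
                          IsFermatQuotient b′ q′
    isFermatQuotient-q′ g-fq ggi≈1 b-fq bc≈1 =
      isFermatQuotient-% b′ (qg + q + k * c′) $
      isFermatQuotient-shift b′ k c′ (qg + q)
        (subst (λ x → IsFermatQuotient x (qg + q)) t≡b′+kP (isFermatQuotient-* g b qg q g-fq b-fq))
        (b′c′≈1 ggi≈1 bc≈1)

  loop-fst : ∀ m (f : ℕ → ℕ) b c q → b ≡ f 0 → (∀ i → f (suc i) ≡ g * f i % P) →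
             map proj₁ (val (loop P g gi qg m b c q)) ≡ applyUpTo (f ∘ suc) m
  loop-fst zero    f b c q _    _      = refl
  loop-fst (suc m) f b c q refl f-step =
    cong₂ _∷_ (sym (f-step 0)) (loop-fst m (f ∘ suc) _ _ _ (sym (f-step 0)) (f-step ∘ suc))

  loop-fq : IsFermatQuotient g qg → g * gi ≈ₚ 1 →
            ∀ m b c q → IsFermatQuotient b q → b * c ≈ₚ 1 →
            All (λ x → proj₂ x ≡ fq P (proj₁ x)) (val (loop P g gi qg m b c q))
  loop-fq g-fq ggi≈1 zero    b c q b-fq bc≈1 = []
  loop-fq g-fq ggi≈1 (suc m) b c q b-fq bc≈1 =
    sym (fq-unique b′ q′ b′-fq (m%n<n (qg + q + k * c′) P)) ∷
    loop-fq g-fq ggi≈1 m b′ c′ q′ b′-fq (b′c′≈1 ggi≈1 bc≈1)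
    where
    open Step b c q
    b′-fq = isFermatQuotient-q′ g-fq ggi≈1 b-fq bc≈1

  loop-ops : ∀ m b c q → ops (loop P g gi qg m b c q) ≡ 10 * m
  loop-ops zero    b c q = refl
  loop-ops (suc m) b c q = begin
    10 + (ops (loop P g gi qg m b′ c′ q′) + 0) ≡⟨ cong (10 +_) (+-identityʳ _) ⟩
    10 + ops (loop P g gi qg m b′ c′ q′)       ≡⟨ cong (10 +_) (loop-ops m b′ c′ q′) ⟩
    10 + 10 * m                                ≡⟨ *-suc 10 m ⟨
    10 * suc m                                 ∎
    where
    open Step b c q
    open ≡-Reasoning

  loop-big : ∀ m b c q B → g < P → gi < P → qg < P → b < P → c < P → q < P →
             P + P + P * P ≤ B → big (loop P g gi qg m b c q) ≤ B
  loop-big zero    b c q B _ _ _ _ _ _ _ = z≤n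
  loop-big (suc m) b c q B g<P gi<P qg<P b<P c<P q<P P+P+P²≤B =
    ⊔-lub (⊔-lub₃ (<P⇒≤B g<P) (<P⇒≤B b<P) t≤B) $
    ⊔-lub (⊔-lub₃ t≤B P≤B (<P⇒≤B b′<P)) $
    ⊔-lub (⊔-lub₃ (<P⇒≤B c<P) (<P⇒≤B gi<P) cgi≤B) $
    ⊔-lub (⊔-lub₃ cgi≤B P≤B (<P⇒≤B c′<P)) $
    ⊔-lub (⊔-lub₃ t≤B (<P⇒≤B b′<P) t∸b′≤B) $
    ⊔-lub (⊔-lub₃ t∸b′≤B P≤B (<P⇒≤B k<P)) $
    ⊔-lub (⊔-lub₃ (<P⇒≤B qg<P) (<P⇒≤B q<P) (≤-trans qg+q≤P+P P+P≤B)) $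
    ⊔-lub (⊔-lub₃ (<P⇒≤B k<P) (<P⇒≤B c′<P) (≤-trans kc′≤P² P²≤B)) $
    ⊔-lub (⊔-lub₃ (≤-trans qg+q≤P+P P+P≤B) (≤-trans kc′≤P² P²≤B) s≤B) $
    ⊔-lub (⊔-lub₃ s≤B P≤B (<P⇒≤B (m%n<n (qg + q + k * c′) P))) $
    ⊔-lub (loop-big m b′ c′ q′ B g<P gi<P qg<P b′<P c′<P (m%n<n (qg + q + k * c′) P) P+P+P²≤B)
          z≤n
    where
    open Step b c q
    P²≤B = ≤-trans (m≤n+m (P * P) (P + P)) P+P+P²≤B
    P+P≤B = ≤-trans (m≤m+n (P + P) (P * P)) P+P+P²≤B
    P≤B = ≤-trans (m≤m*n P P) P²≤B
    <P⇒≤B : ∀ {x} → x < P → x ≤ B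
    <P⇒≤B x<P = ≤-trans (<⇒≤ x<P) P≤B
    t<P² = *-mono-< g<P b<P
    t≤B = ≤-trans (<⇒≤ t<P²) P²≤B
    cgi≤B = ≤-trans (<⇒≤ (*-mono-< c<P gi<P)) P²≤B
    b′<P = m%n<n t P
    c′<P = m%n<n (c * gi) P
    t∸b′≤B = ≤-trans (m∸n≤m t b′) t≤B
    k<P : k < P
    k<P = subst (_< P) (sym ([m∸m%n]/n≡m/n t P)) (m<n*o⇒m/o<n t<P²)
    qg+q≤P+P = +-mono-≤ (<⇒≤ qg<P) (<⇒≤ q<P)
    kc′≤P² = *-mono-≤ (<⇒≤ k<P) (<⇒≤ c′<P)
    s≤B = ≤-trans (+-mono-≤ qg+q≤P+P kc′≤P²) P+P+P²≤B

module PrimitiveRoot (n g : ℕ) (root : IsPrimitiveRoot (3 + n) g) where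
  open FermatQuotient (suc n)
  open ModP using () renaming (_≈_ to _≈ₚ_)

  e : ℕ
  e = suc (suc n)

  F : ℕ → ℕ
  F i = g ^ suc i % P

  g^e≈1 : g ^ e ≈ₚ 1
  g^e≈1 = ModP.mk (proj₁ root)

  complement : ∀ x j → j ≤ e → x ≈ₚ g ^ j → x * g ^ (e ∸ j) ≈ₚ 1
  complement x j j≤e x≈g^j = begin
    x * g ^ (e ∸ j)        ≈⟨ ModP.*-cong x≈g^j (ModP.≈-refl {g ^ (e ∸ j)}) ⟩
    g ^ j * g ^ (e ∸ j)    ≡⟨ ^-distribˡ-+-* g j (e ∸ j) ⟨
    g ^ (j + (e ∸ j))      ≡⟨ cong (g ^_) (m+[n∸m]≡n j≤e) ⟩
    g ^ e                  ≈⟨ g^e≈1 ⟩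
    1                      ∎
    where open ModP.≈-Reasoning

  F≢0 : ∀ {i} → i < suc n → F i ≢ 0
  F≢0 {i} i<1+n F[i]≡0 with () ← ModP.%-≡ (complement 0 (suc i) (s≤s (<⇒≤ i<1+n)) (ModP.mk (sym F[i]≡0)))

  F≢1 : ∀ {i} → i < suc n → F i ≢ 1
  F≢1 {i} i<1+n = proj₂ root (suc i) (s≤s z≤n) (s≤s i<1+n)

  F-distinct : ∀ {i j} → i < j → j < suc n → F i ≢ F j
  F-distinct {i} {j} i<j j<1+n F[i]≡F[j] = proj₂ root d (s≤s z≤n) d<e $ begin
    g ^ (suc i + (e ∸ suc j)) % P     ≡⟨ cong (_% P) (^-distribˡ-+-* g (suc i) (e ∸ suc j)) ⟩
    g ^ suc i * g ^ (e ∸ suc j) % P   ≡⟨ ModP.%-≡ (complement (g ^ suc i) (suc j) 1+j≤e (ModP.mk F[i]≡F[j])) ⟩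
    1                                 ∎
    where
    open ≡-Reasoning
    d = suc i + (e ∸ suc j)
    1+j≤e = s≤s (<⇒≤ j<1+n)
    d<e : d < e
    d<e = ≤-trans (+-monoˡ-< (e ∸ suc j) (s≤s i<j)) (≤-reflexive (m+[n∸m]≡n 1+j≤e))

  residues : List ℕ
  residues = 0 ∷ 1 ∷ applyUpTo F (suc n)

  residues↭upTo : residues ↭ upTo P
  residues↭upTo = unique∧bounded⇒↭upTo P residues residues! residues<P
    (cong (λ l → suc (suc l)) (length-applyUpTo F (suc n)))
    where
    residues! : Unique residues
    residues! = ((λ ()) ∷ applyUpTo⁺₁ F (suc n) (λ i<1+n → F≢0 i<1+n ∘ sym))
              ∷ applyUpTo⁺₁ F (suc n) (λ i<1+n → F≢1 i<1+n ∘ sym)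
              ∷ UniqueP.applyUpTo⁺₁ F (suc n) F-distinct
    residues<P : All (_< P) residues
    residues<P = s≤s z≤n ∷ s≤s (s≤s z≤n) ∷ applyUpTo⁺₁ F (suc n) (λ {i} _ → m%n<n (g ^ suc i) P)

module Algorithm4 (n g : ℕ) (root : IsPrimitiveRoot (3 + n) g) (g<P : g < 3 + n) where
  open FermatQuotient (suc n)
  open ModP using () renaming (_≈_ to _≈ₚ_)
  open PrimitiveRoot n g root

  r gi qg : ℕ
  r  = val (powmod g e (P * P))
  gi = val (powmod g (suc n) P)
  qg = (r ∸ 1) / P

  open Loop (suc n) g gi qg

  r≡ : r ≡ g ^ e % (P * P)
  r≡ = trans (pm-val e 1 g e _ (s≤s (s≤s z≤n)) ≤-refl) (cong (_% (P * P)) (*-identityˡ (g ^ e)))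

  gi≡ : gi ≡ g ^ suc n % P
  gi≡ = trans (pm-val (suc n) 1 g (suc n) _ (s≤s (s≤s z≤n)) ≤-refl) (cong (_% P) (*-identityˡ (g ^ suc n)))

  g-fq : IsFermatQuotient g qg × qg < P
  g-fq = subst (λ x → IsFermatQuotient g ((x ∸ 1) / P) × (x ∸ 1) / P < P) (sym r≡)
               (isFermatQuotient-rem g (proj₁ root))

  ggi≈1 : g * gi ≈ₚ 1
  ggi≈1 = ModP.≈-trans (ModP.*-cong (ModP.≈-refl {g}) (ModP.≈-trans (ModP.≡⇒≈ gi≡) (ModP.m%n≈m (g ^ suc n))))
                       g^e≈1

  A : Costed (List (ℕ × ℕ))
  A = algorithm4 P g

  outputs≡residues : map proj₁ (val A) ≡ residues
  outputs≡residues = cong (λ l → 0 ∷ 1 ∷ l) $ cong₂ _∷_ g≡F0 $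
    loop-fst n F g gi qg g≡F0 F-step
    where
    g≡F0 : g ≡ F 0
    g≡F0 = sym (trans (cong (_% P) (*-identityʳ g)) (m<n⇒m%n≡m g<P))
    F-step : ∀ i → F (suc i) ≡ g * F i % P
    F-step i = ModP.%-≡ (ModP.*-cong (ModP.≈-refl {g}) (ModP.≈-sym (ModP.m%n≈m (g ^ suc i))))

  first-components : map proj₁ (val A) ≡ 0 ∷ 1 ∷ map F (upTo (suc n))
  first-components = trans outputs≡residues (cong (λ l → 0 ∷ 1 ∷ l) (sym (map-upTo F (suc n))))

  outputs↭upTo : map proj₁ (val A) ↭ upTo P
  outputs↭upTo = subst (_↭ upTo P) (sym outputs≡residues) residues↭upTo

  values-correct : All (λ x → proj₂ x ≡ fq P (proj₁ x)) (val A)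
  values-correct =
    refl ∷
    cong (λ x → (x ∸ 1) / P % P) (sym (^-zeroˡ e)) ∷
    sym (fq-unique g qg (proj₁ g-fq) (proj₂ g-fq)) ∷
    loop-fq (proj₁ g-fq) ggi≈1 n g gi qg (proj₁ g-fq) ggi≈1

  ops-bound : ops A ≤ 22 * P
  ops-bound = begin
    2 + (ops (powmod g e (P * P)) + (3 + (ops (powmod g (suc n) P) + (ops (loop P g gi qg n g gi qg) + 0))))
      ≤⟨ +-monoʳ-≤ 2 (+-mono-≤ (pm-ops e 1 g e _) (+-monoʳ-≤ 3 (+-mono-≤ (pm-ops (suc n) 1 g (suc n) _)
                                                      (≤-reflexive (cong (_+ 0) (loop-ops n g gi qg)))))) ⟩
    2 + (6 * e + (3 + (6 * suc n + (10 * n + 0))))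
      ≡⟨ count n ⟩
    23 + 22 * n
      ≤⟨ +-monoˡ-≤ (22 * n) (m≤m+n 23 43) ⟩
    66 + 22 * n
      ≡⟨ total n ⟩
    22 * P ∎
    where
    open ≤-Reasoning
    count : ∀ n → 2 + (6 * (2 + n) + (3 + (6 * (1 + n) + (10 * n + 0)))) ≡ 23 + 22 * n
    count = solve-∀
    total : ∀ n → 66 + 22 * n ≡ 22 * (3 + n)
    total = solve-∀

  big-bound : big A ≤ P ^ 4
  big-bound = subst (big A ≤_) (fourth-power P) $
    ⊔-lub (⊔-lub₃ P≤B P≤B P²≤B) $
    ⊔-lub (⊔-lub₃ P≤B 1≤B (≤-trans (m∸n≤m P 1) P≤B)) $
    ⊔-lub (pm-big e 1 g e _ B 1<P² (≤-trans g<P P≤P²) P≤B 2≤B ≤-refl) $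
    ⊔-lub (⊔-lub₃ r≤B 1≤B r∸1≤B) $
    ⊔-lub (⊔-lub₃ r∸1≤B P≤B (≤-trans (<⇒≤ (proj₂ g-fq)) P≤B)) $
    ⊔-lub (⊔-lub₃ P≤B 2≤B (≤-trans (m∸n≤m P 2) P≤B)) $
    ⊔-lub (pm-big (suc n) 1 g (suc n) _ B (s≤s (s≤s z≤n)) g<P (≤-trans (n≤1+n e) P≤B) 2≤B P²≤B) $
    ⊔-lub (loop-big n g gi qg B g<P gi<P (proj₂ g-fq) g<P gi<P (proj₂ g-fq) P+P+P²≤B)
          z≤n
    where
    B = P * P * (P * P)
    P≤P² = m≤m*n P P
    P²≤B = m≤m*n (P * P) (P * P)
    P≤B = ≤-trans P≤P² P²≤B
    1≤B = ≤-trans (s≤s z≤n) P≤B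
    2≤B = ≤-trans (s≤s (s≤s z≤n)) P≤B
    1<P² = ≤-trans (s≤s (s≤s z≤n)) P≤P²
    r≤B = ≤-trans (<⇒≤ (subst (_< P * P) (sym r≡) (m%n<n (g ^ e) (P * P)))) P²≤B
    r∸1≤B = ≤-trans (m∸n≤m r 1) r≤B
    gi<P = subst (_< P) (sym gi≡) (m%n<n (g ^ suc n) P)
    P+P+P²≤B : P + P + P * P ≤ B
    P+P+P²≤B = begin
      P + P + P * P              ≤⟨ +-monoˡ-≤ (P * P) (+-mono-≤ P≤P² P≤P²) ⟩
      P * P + P * P + P * P      ≡⟨ triple (P * P) ⟩
      3 * (P * P)                ≤⟨ *-monoˡ-≤ (P * P) (≤-trans (s≤s (s≤s (s≤s z≤n))) P≤P²) ⟩
      B                          ∎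
      where
      open ≤-Reasoning
      triple : ∀ x → x + x + x ≡ 3 * x
      triple = solve-∀
    fourth-power : ∀ x → x * x * (x * x) ≡ x * (x * (x * (x * 1)))
    fourth-power = solve-∀

theorem5 : Σ ℕ λ C₁ → Σ ℕ λ C₂ → ∀ (p g : ℕ) → Prime p → IsPrimitiveRoot p g → 1 < g → g < p →
    (map proj₁ (val (algorithm4 p g)) ≡ 0 ∷ 1 ∷ map (λ i → remN (g ^ suc i) p) (upTo (p ∸ 2)))
    × All (λ x → proj₂ x ≡ fq p (proj₁ x)) (val (algorithm4 p g))
    × (map proj₁ (val (algorithm4 p g)) ↭ upTo p)
    × (ops (algorithm4 p g) ≤ C₁ * p)
    × (big (algorithm4 p g) ≤ p ^ C₂)
theorem5 = 22 , 4 , λ where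
  _ g _ root (s≤s (s≤s _)) g<p@(s≤s (s≤s (s≤s {n = n} _))) →
    let open Algorithm4 n g root g<p
    in first-components , values-correct , outputs↭upTo , ops-bound , big-bound
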